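{- Fix $\alpha\in(0,1)$ and let $(a_n)_{n\ge1}$ be a strictly decreasing sequence of rational numbers in $(0,1)$ converging to $\alpha$. Define binary words $v^{(i)}$ and integers $\ell_i$, $k_i$ as follows: $v^{(1)}=1^{\lceil 10a_1\rceil}0^{10-\lceil 10a_1\rceil}$ and $\ell_1=10-\lceil 10a_1\rceil$; for $i>1$, $$v^{(i)}=\mathrm{pref}_{\mathrm{flipext}^{\omega}(v^{(i-1)})}\big(k_i|v^{(i-1)}|\big)\,0^{\ell_i},\qquad \ell_i=\left\lfloor k_i\left(\frac{|v^{(i-1)}|_1-a_i|v^{(i-1)}|}{a_i}\right)\right\rfloor,$$ where $k_i$ is the smallest integer greater than one such that $\ell_i>\ell_{i-1}$. Then $v=\lim_{i\to\infty}v^{(i)}$ is an aperiodic infinite prefix normal word with $\delta(v)=\alpha$.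
   Context: Binary words are indexed from $1$. $|u|$ is the length and $|u|_1$ the number of $1$s of a finite word $u$; $\mathrm{pref}_w(i)$ is the prefix of length $i$ of $w$ and $P_w(i)=|\mathrm{pref}_w(i)|_1$, $D_w(i)=P_w(i)/i$. A (finite or infinite) binary word $w$ is prefix normal if for every $i\ge 1$ (with $i\le|w|$ if finite) every factor of $w$ of length $i$ has at most $P_w(i)$ ones. The minimum density is $\delta(w)=\inf\{D_w(i): i\ge1\}$ ($1\le i\le |w|$ for finite $w$). For a finite prefix normal word $w$ containing at least one $1$, $\mathrm{flipext}(w)=w0^k1$ where $k=\min\{j\ge0 : w0^j1 \text{ is prefix normal}\}$, and $\mathrm{flipext}^{\omega}(w)=\lim_{i\to\infty}\mathrm{flipext}^{(i)}(w)$ is the infinite word obtained by iterating this operation. An infinite word is aperiodic if it is not of the form $xu^{\omega}$ with $x$ finite and $u$ finite nonempty. -}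

module Defs where

open import Data.Bool using (Bool; true; false; if_then_else_; _∧_)
open import Data.Nat as ℕ using (ℕ; zero; suc; _+_; _*_; _∸_; _≤_; _<_; _≤ᵇ_)
open import Data.Integer as ℤ using (ℤ; +_; -[1+_])
open import Data.Rational as ℚ using (ℚ; mkℚ; 0ℚ; 1/_; floor; ceiling)
open import Data.List using (List; []; _∷_; _++_; length; take; drop; replicate; map; upTo)
open import Data.Product using (Σ; ∃; _×_; _,_)
open import Relation.Binary.PropositionalEquality using (_≡_; _≢_)
open import Relation.Nullary using (¬_)

-- Conventions.  Letter 1 is `true`, 0 is `false`.
-- Finite words: List Bool.  Infinite words: ℕ → Bool, where Agda
-- position n (0-based) is the paper's position n+1.

FinWord : Set
FinWord = List Bool

InfWord : Set
InfWord = ℕ → Bool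

ones : FinWord → ℕ
ones []          = 0
ones (true ∷ u)  = suc (ones u)
ones (false ∷ u) = ones u

prefω : InfWord → ℕ → FinWord
prefω w i = map w (upTo i)

-- letter at (0-based) position n of a finite word (false if out of range;
-- only used in range)
nth : FinWord → ℕ → Bool
nth []      _       = false
nth (b ∷ _) zero    = b
nth (_ ∷ u) (suc n) = nth u n

PrefixNormal : FinWord → Set
PrefixNormal w = ∀ (i j : ℕ) → j + i ≤ length w →
  ones (take i (drop j w)) ≤ ones (take i w)

PrefixNormalω : InfWord → Set
PrefixNormalω w = ∀ (i j : ℕ) →
  ones (prefω (λ n → w (j + n)) i) ≤ ones (prefω w i)

allᵇ : {A : Set} → (A → Bool) → List A → Bool
allᵇ p []       = true
allᵇ p (x ∷ xs) = p x ∧ allᵇ p xs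

isPrefixNormal : FinWord → Bool
isPrefixNormal w =
  allᵇ (λ i → allᵇ (λ j → ones (take i (drop j w)) ≤ᵇ ones (take i w))
                 (upTo (suc (length w ∸ i))))
      (upTo (suc (length w)))

ext : FinWord → ℕ → FinWord
ext w j = w ++ (replicate j false ++ (true ∷ []))

search : FinWord → ℕ → ℕ → ℕ
search w j zero       = j
search w j (suc fuel) = if isPrefixNormal (ext w j) then j else search w (suc j) fuel

-- for w prefix normal containing a 1, some j ≤ |w| works, so the search
-- with fuel |w|+1 returns the true minimum k
flipext : FinWord → FinWord
flipext w = ext w (search w 0 (suc (length w)))

flipextIter : ℕ → FinWord → FinWord
flipextIter zero    w = w
flipextIter (suc n) w = flipext (flipextIter n w)

-- flipext^ω(w): each iterate extends the previous one (by at least one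
-- letter), so the limit's letter at position n is the letter at position n
-- of the n-th iterate (which has length ≥ |w| + n > n for nonempty w).
flipextω : FinWord → InfWord
flipextω w n = nth (flipextIter n w) n

toℚ : ℕ → ℚ
toℚ n = (+ n) ℚ./ 1

-- total reciprocal (only applied to positive numbers below)
inv : ℚ → ℚ
inv (mkℚ (+ zero) _ _)        = 0ℚ
inv p@(mkℚ (+ suc n) _ _)     = 1/ p
inv p@(mkℚ -[1+ n ] _ _)      = 1/ p

-- D_w(i+1) = P_w(i+1)/(i+1)
Dω : InfWord → ℕ → ℚ
Dω w i = (+ ones (prefω w (suc i))) ℚ./ suc i

-- inf_i f i = inf_n g n (as real numbers), stated with rationals only:
-- every f i is ≥ inf g, and every g n is ≥ inf f.
InfEq : (ℕ → ℚ) → (ℕ → ℚ) → Set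
InfEq f g =
  (∀ i ε → 0ℚ ℚ.< ε → ∃ λ n → g n ℚ.< f i ℚ.+ ε) ×
  (∀ n ε → 0ℚ ℚ.< ε → ∃ λ i → f i ℚ.< g n ℚ.+ ε)

-- the infinite word x u^ω for nonempty u = b ∷ us
periodicWord : FinWord → Bool → FinWord → InfWord
periodicWord x b us n =
  if ℕ.suc n ℕ.≤ᵇ length x then nth x n
  else nth (b ∷ us) ((n ∸ length x) ℕ.% suc (length us))

Aperiodic : InfWord → Set
Aperiodic v = ¬ (Σ FinWord λ x → Σ Bool λ b → Σ FinWord λ us →
                   ∀ n → v n ≡ periodicWord x b us n)

-- The construction (indices shifted: Agda index i ↔ paper index i+1;
-- a i = a_{i+1}, V i = v^{(i+1)}, L i = ℓ_{i+1}, K i = k_{i+1}; K 0 unused)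

c₁ : (ℕ → ℚ) → ℕ
c₁ a = ℤ.∣ ceiling (toℚ 10 ℚ.* a 0) ∣

ℓform : ℚ → FinWord → ℕ → ℤ
ℓform a w k = floor (toℚ k ℚ.* ((toℚ (ones w) ℚ.- a ℚ.* toℚ (length w)) ℚ.* inv a))

Construction : (ℕ → ℚ) → (ℕ → FinWord) → (ℕ → ℕ) → (ℕ → ℕ) → Set
Construction a V L K =
  (V 0 ≡ replicate (c₁ a) true ++ replicate (10 ∸ c₁ a) false) ×
  (L 0 ≡ 10 ∸ c₁ a) ×
  (∀ i → (2 ≤ K (suc i)) ×
         (+ L (suc i) ≡ ℓform (a (suc i)) (V i) (K (suc i))) ×
         (L i < L (suc i)) ×
         (∀ k → 2 ≤ k → k < K (suc i) → ℓform (a (suc i)) (V i) k ℤ.≤ + L i) ×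
         (V (suc i) ≡ prefω (flipextω (V i)) (K (suc i) * length (V i))
                        ++ replicate (L (suc i)) false))

IsLimit : (ℕ → FinWord) → InfWord → Set
IsLimit V v = ∀ n → ∃ λ i₀ → ∀ i → i₀ ≤ i →
  (n < length (V i)) × (nth (V i) n ≡ v n)

-- Every v⁽ⁱ⁾ is prefix normal, starts with 1, and all its prefix densities are at least its
-- overall density |v⁽ⁱ⁾|₁/|v⁽ⁱ⁾| ≥ aᵢ.  Prefix normality of u means subadditivity of P u, and
-- by subadditivity w0ʳ1 is prefix normal as soon as its density drops below the minimum prefix
-- density of w; so flipext inserts zeros only while that bound survives, and flipextω(v⁽ⁱ⁾) keeps
-- all prefix densities at least |v⁽ⁱ⁾|₁/|v⁽ⁱ⁾|.  Its prefix of length k|v⁽ⁱ⁾| then has exactly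
-- k|v⁽ⁱ⁾|₁ ones, and ℓᵢ₊₁ is the largest number of appended zeros keeping the density at least
-- aᵢ₊₁.  Hence every prefix density of v is at least every aᵢ, while the density at the end of
-- v⁽ⁱ⁺¹⁾ is below aᵢ₊₁ + 1/|v⁽ⁱ⁺¹⁾|.  The number of ones and the final blocks of zeros both grow
-- without bound, which no eventually periodic word allows.

module Submission where

open import Defs

import Algebra.Properties.CommutativeSemigroup as CommSemigroupProperties
open import Data.Bool using (Bool; true; false; T; if_then_else_)
open import Data.Bool.Properties using (T-∧)
open import Data.Empty using (⊥-elim)
open import Data.Integer as ℤ using (+_; -[1+_]; +≤+; +<+)
import Data.Integer.DivMod as ℤD
import Data.Integer.Properties as ℤP
open import Data.Integer.Tactic.RingSolver using () renaming (solve-∀ to ℤ-solve-∀)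
open import Data.List using ([]; _∷_; _++_; length; take; drop; replicate; map; upTo; applyUpTo)
open import Data.List.Properties
  using (take-all; take-take; take-[]; drop-all; length-drop; length-take; length-++; length-replicate;
         map-applyUpTo; map-++; length-map; length-upTo; upTo-∷ʳ; ++-assoc; ++-identityʳ)
open import Data.List.Relation.Unary.All using (All; []; _∷_)
open import Data.List.Relation.Unary.All.Properties using (applyUpTo⁺₁; applyUpTo⁻)
open import Data.Nat as ℕ using (ℕ; zero; suc; _+_; _*_; _∸_; _≤_; _<_; _≤ᵇ_; _⊓_; z≤n; s≤s; s≤s⁻¹)
open import Data.Nat.Coprimality using (Coprime)
open import Data.Nat.DivMod
  using (_/_; _%_; m≡m%n+[m/n]*n; m%n<n; m/n*n≤m; m*n/n≡m; /-monoˡ-≤; [m+kn]%n≡m%n; m<n⇒m%n≡m)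
open import Data.Nat.Properties
open import Data.Nat.Tactic.RingSolver using () renaming (solve-∀ to ℕ-solve-∀)
open import Data.Product using (Σ; ∃; _×_; _,_; proj₁; proj₂)
open import Data.Rational as ℚ using (ℚ; mkℚ; 0ℚ; 1ℚ; ↥_; ↧_; ↧ₙ_; toℚᵘ; *<*)
import Data.Rational.Properties as ℚP
open import Data.Rational.Unnormalised as ℚᵘ using (ℚᵘ; mkℚᵘ; *≡*)
import Data.Rational.Unnormalised.Properties as ℚᵘP
open import Data.Sum using (_⊎_; inj₁; inj₂)
open import Data.Unit using (tt)
open import Function using (_∘_; id)
open import Function.Bundles using (Equivalence)
open import Relation.Binary.PropositionalEquality
open import Relation.Nullary using (¬_; yes; no)

open CommSemigroupProperties *-commutativeSemigroup using (x∙yz≈y∙xz; xy∙z≈xz∙y)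
module ℤ* = CommSemigroupProperties ℤP.*-commutativeSemigroup

P : FinWord → ℕ → ℕ
P u i = ones (take i u)

ones-++ : ∀ u s → ones (u ++ s) ≡ ones u + ones s
ones-++ []          s = refl
ones-++ (true ∷ u)  s = cong suc (ones-++ u s)
ones-++ (false ∷ u) s = ones-++ u s

ones-zeros : ∀ n → ones (replicate n false) ≡ 0
ones-zeros zero    = refl
ones-zeros (suc n) = ones-zeros n

ones-replicate-true : ∀ n → ones (replicate n true) ≡ n
ones-replicate-true zero    = refl
ones-replicate-true (suc n) = cong suc (ones-replicate-true n)

ones≤length : ∀ u → ones u ≤ length u
ones≤length []          = z≤n
ones≤length (true ∷ u)  = s≤s (ones≤length u)
ones≤length (false ∷ u) = m≤n⇒m≤1+n (ones≤length u)

take-++ : ∀ i (u s : FinWord) → take i (u ++ s) ≡ take i u ++ take (i ∸ length u) s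
take-++ zero    []      s = refl
take-++ zero    (b ∷ u) s = refl
take-++ (suc i) []      s = refl
take-++ (suc i) (b ∷ u) s = cong (b ∷_) (take-++ i u s)

take-+ : ∀ j i (u : FinWord) → take (j + i) u ≡ take j u ++ take i (drop j u)
take-+ zero    i       u       = refl
take-+ (suc j) zero    []      = refl
take-+ (suc j) (suc i) []      = refl
take-+ (suc j) i       (b ∷ u) = cong (b ∷_) (take-+ j i u)

take-⊓-length : ∀ i (u : FinWord) → take i u ≡ take (i ⊓ length u) u
take-⊓-length i u = trans (cong (take i) (sym (take-all (length u) u ≤-refl))) (take-take i (length u) u)

P-++ : ∀ u s i → P (u ++ s) i ≡ P u i + P s (i ∸ length u)
P-++ u s i = trans (cong ones (take-++ i u s)) (ones-++ (take i u) _)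

P-+ : ∀ u j i → P u (j + i) ≡ P u j + ones (take i (drop j u))
P-+ u j i = trans (cong ones (take-+ j i u)) (ones-++ (take j u) _)

P-all : ∀ u {i} → length u ≤ i → P u i ≡ ones u
P-all u {i} le = cong ones (take-all i u le)

P≤ones : ∀ u i → P u i ≤ ones u
P≤ones []          zero    = z≤n
P≤ones []          (suc i) = z≤n
P≤ones (b ∷ u)     zero    = z≤n
P≤ones (true ∷ u)  (suc i) = s≤s (P≤ones u i)
P≤ones (false ∷ u) (suc i) = P≤ones u i

P-mono : ∀ u {i j} → i ≤ j → P u i ≤ P u j
P-mono u           {zero}  _         = z≤n
P-mono []          {suc i} _         = z≤n
P-mono (true ∷ u)  {suc i} (s≤s i≤j) = s≤s (P-mono u i≤j)
P-mono (false ∷ u) {suc i} (s≤s i≤j) = P-mono u i≤j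

P-take : ∀ u m i → P (take m u) i ≡ P u (i ⊓ m)
P-take u m i = cong ones (take-take i m u)

P-prefix : ∀ u s {i} → i ≤ length u → P (u ++ s) i ≡ P u i
P-prefix u s {i} le = trans (P-++ u s i) (trans (cong (λ n → P u i + P s n) (m≤n⇒m∸n≡0 le)) (+-identityʳ _))

P-zeros-++ : ∀ n s {i} → i ≤ n → P (replicate n false ++ s) i ≡ 0
P-zeros-++ n       s {zero}  _         = refl
P-zeros-++ (suc n) s {suc i} (s≤s i≤n) = P-zeros-++ n s i≤n

P-++-zeros : ∀ u n i → P (u ++ replicate n false) i ≡ P u i
P-++-zeros u n i = trans (P-++ u _ i) (trans (cong (_+_ (P u i)) zeros) (+-identityʳ _))
  where
  zeros : P (replicate n false) (i ∸ length u) ≡ 0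
  zeros = n≤0⇒n≡0 (≤-trans (P≤ones _ (i ∸ length u)) (≤-reflexive (ones-zeros n)))

P-replicate-true : ∀ c i → P (replicate c true) i ≡ i ⊓ c
P-replicate-true zero    zero    = refl
P-replicate-true zero    (suc i) = refl
P-replicate-true (suc c) zero    = refl
P-replicate-true (suc c) (suc i) = cong suc (P-replicate-true c i)

⊓-subadditive : ∀ m i j → (j + i) ⊓ m ≤ j ⊓ m + i ⊓ m
⊓-subadditive m i j with m ≤? j | m ≤? i
... | yes m≤j | _       =
  ≤-trans (m⊓n≤n (j + i) m) (≤-trans (≤-reflexive (sym (m≥n⇒m⊓n≡n m≤j))) (m≤m+n _ _))
... | no _    | yes m≤i =
  ≤-trans (m⊓n≤n (j + i) m) (≤-trans (≤-reflexive (sym (m≥n⇒m⊓n≡n m≤i))) (m≤n+m _ _))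
... | no m≰j  | no m≰i  = ≤-trans (m⊓n≤m (j + i) m)
  (≤-reflexive (sym (cong₂ _+_ (m≤n⇒m⊓n≡m (<⇒≤ (≰⇒> m≰j))) (m≤n⇒m⊓n≡m (<⇒≤ (≰⇒> m≰i))))))

div-bounds : ∀ m n .{{_ : ℕ.NonZero n}} → m / n * n ≤ m × m < suc (m / n) * n
div-bounds m n = m/n*n≤m m n , (begin-strict
  m                  ≡⟨ m≡m%n+[m/n]*n m n ⟩
  m % n + m / n * n  <⟨ +-monoˡ-< (m / n * n) (m%n<n m n) ⟩
  n + m / n * n      ∎)
  where open ≤-Reasoning

nth-drop : ∀ (u : FinWord) j k → nth (drop j u) k ≡ nth u (j + k)
nth-drop u       zero    k = refl
nth-drop []      (suc j) k = refl
nth-drop (b ∷ u) (suc j) k = nth-drop u j k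

nth-++ : ∀ u s {n} → n < length u → nth (u ++ s) n ≡ nth u n
nth-++ (b ∷ u) s {zero}  _         = refl
nth-++ (b ∷ u) s {suc n} (s≤s n<) = nth-++ u s n<

nth-++-≥ : ∀ u s {p} → length u ≤ p → nth (u ++ s) p ≡ nth s (p ∸ length u)
nth-++-≥ []      s {p}     _         = refl
nth-++-≥ (b ∷ u) s {suc p} (s≤s |u|≤p) = nth-++-≥ u s |u|≤p

nth-zeros : ∀ ℓ p → nth (replicate ℓ false) p ≡ false
nth-zeros zero    p       = refl
nth-zeros (suc ℓ) zero    = refl
nth-zeros (suc ℓ) (suc p) = nth-zeros ℓ p

some-true-or-all-false : ∀ u → (∃ λ t → t < length u × nth u t ≡ true) ⊎ (∀ t → nth u t ≡ false)
some-true-or-all-false []          = inj₂ λ _ → refl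
some-true-or-all-false (true ∷ u)  = inj₁ (0 , s≤s z≤n , refl)
some-true-or-all-false (false ∷ u) with some-true-or-all-false u
... | inj₁ (t , t< , one) = inj₁ (suc t , s≤s t< , one)
... | inj₂ all-false      = inj₂ λ { zero → refl ; (suc t) → all-false t }

infix 4 _≼_

_≼_ : FinWord → FinWord → Set
u ≼ w = ∃ λ s → w ≡ u ++ s

≼-refl : ∀ {u} → u ≼ u
≼-refl {u} = [] , sym (++-identityʳ u)

≼-trans : ∀ {u v w} → u ≼ v → v ≼ w → u ≼ w
≼-trans {u} (s , refl) (t , refl) = s ++ t , ++-assoc u s t

≼-++ : ∀ u s → u ≼ u ++ s
≼-++ u s = s , refl

≼-take : ∀ {u w} m → u ≼ w → length u ≤ m → u ≼ take m w
≼-take {u} m (s , refl) |u|≤m = take (m ∸ length u) s ,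
  trans (take-++ m u s) (cong (_++ take (m ∸ length u) s) (take-all m u |u|≤m))

nth-≼ : ∀ {u w} → u ≼ w → ∀ {n} → n < length u → nth w n ≡ nth u n
nth-≼ {u} (s , refl) = nth-++ u s

P-≼ : ∀ {u w} → u ≼ w → ∀ {x} → x ≤ length u → P w x ≡ P u x
P-≼ {u} (s , refl) = P-prefix u s

applyUpTo-nth : ∀ (f : ℕ → Bool) u {N} → (∀ k → k < N → f k ≡ nth u k) → N ≤ length u →
  applyUpTo f N ≡ take N u
applyUpTo-nth f u       {zero}  _     _        = refl
applyUpTo-nth f (b ∷ u) {suc N} agree (s≤s N≤) =
  cong₂ _∷_ (agree 0 (s≤s z≤n)) (applyUpTo-nth (f ∘ suc) u (λ k k< → agree (suc k) (s≤s k<)) N≤)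

prefω-nth : ∀ (v : InfWord) u {N} → (∀ k → k < N → v k ≡ nth u k) → N ≤ length u →
  prefω v N ≡ take N u
prefω-nth v u agree N≤ = trans (map-applyUpTo id v _) (applyUpTo-nth v u agree N≤)

length-prefω : ∀ v N → length (prefω v N) ≡ N
length-prefω v N = trans (length-map v (upTo N)) (length-upTo N)

ones-prefω-suc : ∀ v N → ones (prefω v (suc N)) ≡ ones (prefω v N) + ones (v N ∷ [])
ones-prefω-suc v N = begin
  ones (map v (upTo (suc N)))             ≡⟨ cong (ones ∘ map v) (upTo-∷ʳ N) ⟨
  ones (map v (upTo N ++ N ∷ []))         ≡⟨ cong ones (map-++ v (upTo N) (N ∷ [])) ⟩
  ones (prefω v N ++ v N ∷ [])            ≡⟨ ones-++ (prefω v N) (v N ∷ []) ⟩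
  ones (prefω v N) + ones (v N ∷ [])      ∎
  where open ≡-Reasoning

ones-prefω-≤ : ∀ (v : InfWord) s → (∀ p → s ≤ p → v p ≡ false) → ∀ N → ones (prefω v N) ≤ s
ones-prefω-≤ v s zeros zero = z≤n
ones-prefω-≤ v s zeros (suc N) with s ≤? N
... | yes s≤N = begin
  ones (prefω v (suc N))                  ≡⟨ ones-prefω-suc v N ⟩
  ones (prefω v N) + ones (v N ∷ [])      ≡⟨ cong (λ b → ones (prefω v N) + ones (b ∷ [])) (zeros N s≤N) ⟩
  ones (prefω v N) + 0                    ≡⟨ +-identityʳ _ ⟩
  ones (prefω v N)                        ≤⟨ ones-prefω-≤ v s zeros N ⟩
  s                                       ∎
  where open ≤-Reasoning
... | no s≰N =
  ≤-trans (ones≤length (prefω v (suc N))) (≤-trans (≤-reflexive (length-prefω v (suc N))) (≰⇒> s≰N))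

-- Prefix normality as subadditivity

Subadditive : FinWord → Set
Subadditive u = ∀ i j → P u (j + i) ≤ P u j + P u i

factor-ones≤P : ∀ {u} → PrefixNormal u → ∀ i j → ones (take i (drop j u)) ≤ P u i
factor-ones≤P {u} pn i j with j ≤? length u
... | no j≰|u| rewrite drop-all j u (<⇒≤ (≰⇒> j≰|u|)) | take-[] {A = Bool} i = z≤n
... | yes j≤|u| = begin
  ones (take i (drop j u))   ≡⟨ cong ones (take-⊓-length i (drop j u)) ⟩
  ones (take i′ (drop j u))  ≤⟨ pn i′ j fits ⟩
  P u i′                     ≤⟨ P-mono u (m⊓n≤m i _) ⟩
  P u i                      ∎
  where
  open ≤-Reasoning
  i′ = i ⊓ length (drop j u)
  fits : j + i′ ≤ length u
  fits = begin
    j + i′                 ≤⟨ +-monoʳ-≤ j (m⊓n≤n i _) ⟩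
    j + length (drop j u)  ≡⟨ cong (_+_ j) (length-drop j u) ⟩
    j + (length u ∸ j)     ≡⟨ m+[n∸m]≡n j≤|u| ⟩
    length u               ∎

prefixNormal⇒subadditive : ∀ {u} → PrefixNormal u → Subadditive u
prefixNormal⇒subadditive {u} pn i j = begin
  P u (j + i)                      ≡⟨ P-+ u j i ⟩
  P u j + ones (take i (drop j u)) ≤⟨ +-monoʳ-≤ (P u j) (factor-ones≤P pn i j) ⟩
  P u j + P u i                    ∎
  where open ≤-Reasoning

subadditive⇒prefixNormal : ∀ {u} → Subadditive u → PrefixNormal u
subadditive⇒prefixNormal {u} sa i j _ = +-cancelˡ-≤ (P u j) _ _ (begin
  P u j + ones (take i (drop j u)) ≡⟨ P-+ u j i ⟨
  P u (j + i)                      ≤⟨ sa i j ⟩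
  P u j + P u i                    ∎)
  where open ≤-Reasoning

subadditive-take : ∀ {u} m → Subadditive u → Subadditive (take m u)
subadditive-take {u} m sa i j = begin
  P (take m u) (j + i)             ≡⟨ P-take u m (j + i) ⟩
  P u ((j + i) ⊓ m)                ≤⟨ P-mono u (⊓-subadditive m i j) ⟩
  P u (j ⊓ m + i ⊓ m)              ≤⟨ sa (i ⊓ m) (j ⊓ m) ⟩
  P u (j ⊓ m) + P u (i ⊓ m)        ≡⟨ cong₂ _+_ (P-take u m j) (P-take u m i) ⟨
  P (take m u) j + P (take m u) i  ∎
  where open ≤-Reasoning

subadditive-++-zeros : ∀ {u} n → Subadditive u → Subadditive (u ++ replicate n false)
subadditive-++-zeros {u} n sa i j
  rewrite P-++-zeros u n (j + i) | P-++-zeros u n j | P-++-zeros u n i = sa i j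

subadditive-replicate-true : ∀ c → Subadditive (replicate c true)
subadditive-replicate-true c i j
  rewrite P-replicate-true c (j + i) | P-replicate-true c j | P-replicate-true c i = ⊓-subadditive c i j

P-*≤ : ∀ {u} → Subadditive u → ∀ k N → P u (k * N) ≤ k * P u N
P-*≤ sa zero    N = z≤n
P-*≤ sa (suc k) N = ≤-trans (sa (k * N) N) (+-monoʳ-≤ _ (P-*≤ sa k N))

allᵇ⁻ : ∀ {A : Set} (p : A → Bool) xs → T (allᵇ p xs) → All (T ∘ p) xs
allᵇ⁻ p []       _ = []
allᵇ⁻ p (x ∷ xs) t = proj₁ both ∷ allᵇ⁻ p xs (proj₂ both)
  where both = Equivalence.to T-∧ t

allᵇ⁺ : ∀ {A : Set} (p : A → Bool) xs → All (T ∘ p) xs → T (allᵇ p xs)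
allᵇ⁺ p []       []         = tt
allᵇ⁺ p (x ∷ xs) (px ∷ pxs) = Equivalence.from T-∧ (px , allᵇ⁺ p xs pxs)

isPrefixNormal-sound : ∀ w → T (isPrefixNormal w) → PrefixNormal w
isPrefixNormal-sound w t i j j+i≤ = ≤ᵇ⇒≤ _ _
  (applyUpTo⁻ id _ (allᵇ⁻ _ _ (applyUpTo⁻ id _ (allᵇ⁻ _ _ t) i<)) j<)
  where
  i< : i < suc (length w)
  i< = s≤s (≤-trans (m≤n+m i j) j+i≤)
  j< : j < suc (length w ∸ i)
  j< = s≤s (≤-trans (≤-reflexive (sym (m+n∸n≡m j i))) (∸-monoˡ-≤ i j+i≤))

isPrefixNormal-complete : ∀ w → PrefixNormal w → T (isPrefixNormal w)
isPrefixNormal-complete w pn = allᵇ⁺ _ _ (applyUpTo⁺₁ id _ λ {i} i< →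
  allᵇ⁺ _ _ (applyUpTo⁺₁ id _ λ {j} j< → ≤⇒≤ᵇ (pn i j (fits i< j<))))
  where
  fits : ∀ {i j} → i < suc (length w) → j < suc (length w ∸ i) → j + i ≤ length w
  fits {i} (s≤s i≤) (s≤s j≤) = ≤-trans (+-monoˡ-≤ i j≤) (≤-reflexive (m∸n+n≡m i≤))

firstFrom : (ℕ → Bool) → ℕ → ℕ → ℕ
firstFrom f s zero       = s
firstFrom f s (suc fuel) = if f s then s else firstFrom f (suc s) fuel

record IsFirstFrom (f : ℕ → Bool) (s r : ℕ) : Set where
  field
    start≤ : s ≤ r
    holds : T (f r)
    minimal : ∀ j → s ≤ j → j < r → ¬ T (f j)

firstFrom-isFirst : ∀ f s fuel t → t < fuel → T (f (s + t)) → IsFirstFrom f s (firstFrom f s fuel)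
firstFrom-isFirst f s (suc fuel) t t<fuel ft with f s in fs
... | true = record
  { start≤ = ≤-refl
  ; holds = subst T (sym fs) tt
  ; minimal = λ j s≤j j<s → ⊥-elim (<⇒≱ j<s s≤j) }
... | false with t
...   | zero = ⊥-elim (subst T (trans (cong f (+-identityʳ s)) fs) ft)
...   | suc t = record
  { start≤ = ≤-trans (n≤1+n s) start≤
  ; holds = holds
  ; minimal = minimal′ }
  where
  open IsFirstFrom (firstFrom-isFirst f (suc s) fuel t (s≤s⁻¹ t<fuel) (subst (T ∘ f) (+-suc s t) ft))
  minimal′ : ∀ j → s ≤ j → j < firstFrom f (suc s) fuel → ¬ T (f j)
  minimal′ j s≤j j<r with m≤n⇒m<n∨m≡n s≤j
  ... | inj₁ s<j   = minimal j s<j j<r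
  ... | inj₂ refl  = subst T fs

-- Density bounds

Dense : ℕ → ℕ → FinWord → Set
Dense p q u = ∀ x → x ≤ length u → x * p ≤ P u x * q

Dense-take : ∀ {p q u} m → Dense p q u → Dense p q (take m u)
Dense-take {p} {q} {u} m d x x≤ = begin
  x * p                 ≤⟨ d x (≤-trans x≤|T| (m⊓n≤n m _)) ⟩
  P u x * q             ≡⟨ cong (λ y → P u y * q) (m≤n⇒m⊓n≡m (≤-trans x≤|T| (m⊓n≤m m _))) ⟨
  P u (x ⊓ m) * q       ≡⟨ cong (_* q) (P-take u m x) ⟨
  P (take m u) x * q    ∎
  where
  open ≤-Reasoning
  x≤|T| : x ≤ m ⊓ length u
  x≤|T| = ≤-trans x≤ (≤-reflexive (length-take m u))

Dense-scale : ∀ {p q u} k → Dense p q u → Dense (k * p) (k * q) u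
Dense-scale {p} {q} {u} k d x x≤ = begin
  x * (k * p)       ≡⟨ x∙yz≈y∙xz x k p ⟩
  k * (x * p)       ≤⟨ *-monoʳ-≤ k (d x x≤) ⟩
  k * (P u x * q)   ≡⟨ x∙yz≈y∙xz k (P u x) q ⟩
  P u x * (k * q)   ∎
  where open ≤-Reasoning

Dense-weaken : ∀ {p q u m e} .{{_ : ℕ.NonZero q}} → Dense p q u → m * q ≤ p * e → Dense m e u
Dense-weaken {p} {q} {u} {m} {e} d mq≤pe x x≤ = *-cancelʳ-≤ (x * m) (P u x * e) q (begin
  x * m * q       ≡⟨ *-assoc x m q ⟩
  x * (m * q)     ≤⟨ *-monoʳ-≤ x mq≤pe ⟩
  x * (p * e)     ≡⟨ *-assoc x p e ⟨
  x * p * e       ≤⟨ *-monoˡ-≤ e (d x x≤) ⟩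
  P u x * q * e   ≡⟨ xy∙z≈xz∙y (P u x) q e ⟩
  P u x * e * q   ∎)
  where open ≤-Reasoning

Dense-++-zeros : ∀ {u} ℓ → Dense (ones u) (length u) u →
  Dense (ones (u ++ replicate ℓ false)) (length (u ++ replicate ℓ false)) (u ++ replicate ℓ false)
Dense-++-zeros {u} ℓ d x x≤
  rewrite ones-++ u (replicate ℓ false) | ones-zeros ℓ | +-identityʳ (ones u)
        | length-++ u {replicate ℓ false} | length-replicate {A = Bool} ℓ {false} | P-++-zeros u ℓ x
  with x ≤? length u
... | yes x≤|u| = ≤-trans (d x x≤|u|) (*-monoʳ-≤ (P u x) (m≤m+n (length u) ℓ))
... | no x≰|u| = begin
  x * ones u                  ≤⟨ *-monoˡ-≤ (ones u) x≤ ⟩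
  (length u + ℓ) * ones u     ≡⟨ *-comm (length u + ℓ) (ones u) ⟩
  ones u * (length u + ℓ)     ≡⟨ cong (_* (length u + ℓ)) (P-all u (<⇒≤ (≰⇒> x≰|u|))) ⟨
  P u x * (length u + ℓ)      ∎
  where open ≤-Reasoning

Dense-replicate-true : ∀ c → Dense (ones (replicate c true)) (length (replicate c true)) (replicate c true)
Dense-replicate-true c x x≤ = ≤-reflexive (begin
  x * ones (replicate c true)           ≡⟨ cong (x *_) (ones-replicate-true c) ⟩
  x * c                                 ≡⟨ cong (_* c) (m≤n⇒m⊓n≡m x≤c) ⟨
  (x ⊓ c) * c                           ≡⟨ cong₂ _*_ (P-replicate-true c x) (length-replicate c) ⟨
  P (replicate c true) x * length (replicate c true) ∎)
  where
  open ≡-Reasoning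
  x≤c : x ≤ c
  x≤c = ≤-trans x≤ (≤-reflexive (length-replicate c))

cross-<-≤-trans : ∀ {x y a b c d} .{{_ : ℕ.NonZero b}} .{{_ : ℕ.NonZero d}} →
  x * b < a * y → a * d ≤ c * b → x * d < c * y
cross-<-≤-trans {x} {y} {a} {b} {c} {d} x/y<a/b a/b≤c/d = *-cancelʳ-< b (x * d) (c * y) (begin-strict
  x * d * b   ≡⟨ xy∙z≈xz∙y x d b ⟩
  x * b * d   <⟨ *-monoˡ-< d x/y<a/b ⟩
  a * y * d   ≡⟨ xy∙z≈xz∙y a y d ⟩
  a * d * y   ≤⟨ *-monoˡ-≤ y a/b≤c/d ⟩
  c * b * y   ≡⟨ xy∙z≈xz∙y c b y ⟩
  c * y * b   ∎)
  where open ≤-Reasoning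

-- flipext

data StartsWithOne : FinWord → Set where
  starts : ∀ u → StartsWithOne (true ∷ u)

startsWithOne-++ : ∀ {w} s → StartsWithOne w → StartsWithOne (w ++ s)
startsWithOne-++ s (starts u) = starts (u ++ s)

startsWithOne-take : ∀ {w} m → 1 ≤ m → StartsWithOne w → StartsWithOne (take m w)
startsWithOne-take (suc m) _ (starts u) = starts (take m u)

startsWithOne-replicate : ∀ {c} → 1 ≤ c → StartsWithOne (replicate c true)
startsWithOne-replicate {suc c} _ = starts (replicate c true)

1≤length : ∀ {w} → StartsWithOne w → 1 ≤ length w
1≤length (starts u) = s≤s z≤n

1≤P : ∀ {w} → StartsWithOne w → ∀ {x} → 1 ≤ x → 1 ≤ P w x
1≤P (starts u) {suc x} _ = s≤s z≤n

ones-zeros-1 : ∀ r → ones (replicate r false ++ true ∷ []) ≡ 1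
ones-zeros-1 zero    = refl
ones-zeros-1 (suc r) = ones-zeros-1 r

length-ext : ∀ w r → length (ext w r) ≡ suc (length w + r)
length-ext w r = begin
  length (ext w r)                                     ≡⟨ length-++ w ⟩
  length w + length (replicate r false ++ true ∷ [])   ≡⟨ cong (_+_ (length w)) (length-++ (replicate r false)) ⟩
  length w + (length (replicate r false) + 1)          ≡⟨ cong (λ n → length w + (n + 1)) (length-replicate r) ⟩
  length w + (r + 1)                                   ≡⟨ cong (_+_ (length w)) (+-comm r 1) ⟩
  length w + suc r                                     ≡⟨ +-suc (length w) r ⟩
  suc (length w + r)                                   ∎
  where open ≡-Reasoning

ones-ext : ∀ w r → ones (ext w r) ≡ suc (ones w)
ones-ext w r = trans (ones-++ w _) (trans (cong (_+_ (ones w)) (ones-zeros-1 r)) (+-comm (ones w) 1))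

P-ext-≤ : ∀ w r {x} → x ≤ length w + r → P (ext w r) x ≡ P w x
P-ext-≤ w r {x} x≤ = trans (P-++ w _ x) (trans (cong (_+_ (P w x)) (P-zeros-++ r _ x∸L≤r)) (+-identityʳ _))
  where
  x∸L≤r : x ∸ length w ≤ r
  x∸L≤r = ≤-trans (∸-monoˡ-≤ (length w) x≤) (≤-reflexive (m+n∸m≡n (length w) r))

P-ext-> : ∀ w r {x} → length w + r < x → P (ext w r) x ≡ suc (ones w)
P-ext-> w r over = trans (P-all (ext w r) (≤-trans (≤-reflexive (length-ext w r)) over)) (ones-ext w r)

ones≤P-ext : ∀ w r {x} → length w ≤ x → ones w ≤ P (ext w r) x
ones≤P-ext w r {x} L≤x = begin
  ones w                ≡⟨ P-all w ≤-refl ⟨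
  P w (length w)        ≡⟨ P-ext-≤ w r (m≤m+n (length w) r) ⟨
  P (ext w r) (length w) ≤⟨ P-mono (ext w r) L≤x ⟩
  P (ext w r) x         ∎
  where open ≤-Reasoning

-- appending 0ʳ1 can only break subadditivity at a split j + i > |w| + r with j, i < |w|
ext-subadditive : ∀ {w} r → Subadditive w → StartsWithOne w →
  (∀ j i → j < length w → i < length w → length w + r < j + i → ones w < P w j + P w i) →
  Subadditive (ext w r)
ext-subadditive {w} r sa h short zero j = ≤-reflexive (trans (cong (P (ext w r)) (+-identityʳ j)) (sym (+-identityʳ _)))
ext-subadditive {w} r sa h short (suc i) zero = ≤-refl
ext-subadditive {w} r sa h short i@(suc _) j@(suc _) with j + i ≤? length w + r
... | yes fits = begin
  P e (j + i)     ≡⟨ P-ext-≤ w r fits ⟩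
  P w (j + i)     ≤⟨ sa i j ⟩
  P w j + P w i   ≡⟨ cong₂ _+_ (P-ext-≤ w r (≤-trans (m≤m+n j i) fits))
                               (P-ext-≤ w r (≤-trans (m≤n+m i j) fits)) ⟨
  P e j + P e i   ∎
  where
  open ≤-Reasoning
  e = ext w r
... | no overflow = begin
  P e (j + i)     ≡⟨ P-ext-> w r (≰⇒> overflow) ⟩
  suc (ones w)    ≤⟨ enough ⟩
  P e j + P e i   ∎
  where
  open ≤-Reasoning
  e = ext w r
  1≤P-e : ∀ {x} → 1 ≤ x → 1 ≤ P e x
  1≤P-e = 1≤P (startsWithOne-++ _ h)
  enough : ones w < P e j + P e i
  enough with length w ≤? j | length w ≤? i
  ... | yes L≤j | _       =
    ≤-trans (≤-reflexive (+-comm 1 (ones w))) (+-mono-≤ (ones≤P-ext w r L≤j) (1≤P-e (s≤s z≤n)))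
  ... | no _    | yes L≤i = +-mono-≤ (1≤P-e (s≤s z≤n)) (ones≤P-ext w r L≤i)
  ... | no L≰j  | no L≰i  = subst (ones w <_)
    (sym (cong₂ _+_ (P-ext-≤ w r (≤-trans (<⇒≤ (≰⇒> L≰j)) (m≤m+n _ r)))
                    (P-ext-≤ w r (≤-trans (<⇒≤ (≰⇒> L≰i)) (m≤m+n _ r)))))
    (short j i (≰⇒> L≰j) (≰⇒> L≰i) (≰⇒> overflow))

ext-prefixNormal-long : ∀ {w} r → PrefixNormal w → StartsWithOne w → length w ≤ r → PrefixNormal (ext w r)
ext-prefixNormal-long {w} r pn h L≤r = subadditive⇒prefixNormal (ext-subadditive r (prefixNormal⇒subadditive pn) h
  λ j i j< i< over → ⊥-elim (<⇒≱ over
    (≤-trans (+-mono-≤ (<⇒≤ j<) (<⇒≤ i<)) (+-monoʳ-≤ (length w) L≤r))))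

ext-prefixNormal-sparse : ∀ {p q w} r → PrefixNormal w → StartsWithOne w → Dense p q w →
  ones w * q < (length w + suc r) * p → PrefixNormal (ext w r)
ext-prefixNormal-sparse {p} {q} {w} r pn h d sparse = subadditive⇒prefixNormal
  (ext-subadditive r (prefixNormal⇒subadditive pn) h λ j i j< i< over →
    *-cancelʳ-< q (ones w) (P w j + P w i) (begin-strict
      ones w * q                <⟨ sparse ⟩
      (length w + suc r) * p    ≤⟨ *-monoˡ-≤ p (≤-trans (≤-reflexive (+-suc (length w) r)) over) ⟩
      (j + i) * p               ≡⟨ *-distribʳ-+ p j i ⟩
      j * p + i * p             ≤⟨ +-mono-≤ (d j (<⇒≤ j<)) (d i (<⇒≤ i<)) ⟩
      P w j * q + P w i * q     ≡⟨ *-distribʳ-+ q (P w j) (P w i) ⟨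
      (P w j + P w i) * q       ∎))
  where open ≤-Reasoning

Dense-ext : ∀ {p q w} r → p ≤ q → Dense p q w → (length w + r) * p ≤ ones w * q → Dense p q (ext w r)
Dense-ext {p} {q} {w} r p≤q d bound x x≤ with x ≤? length w | x ≤? length w + r
... | yes x≤L | _ = begin
  x * p                ≤⟨ d x x≤L ⟩
  P w x * q            ≡⟨ cong (_* q) (P-ext-≤ w r (≤-trans x≤L (m≤m+n _ r))) ⟨
  P (ext w r) x * q    ∎
  where open ≤-Reasoning
... | no x≰L | yes x≤L+r = begin
  x * p                ≤⟨ *-monoˡ-≤ p x≤L+r ⟩
  (length w + r) * p   ≤⟨ bound ⟩
  ones w * q           ≡⟨ cong (_* q) (trans (P-ext-≤ w r x≤L+r) (P-all w (<⇒≤ (≰⇒> x≰L)))) ⟨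
  P (ext w r) x * q    ∎
  where open ≤-Reasoning
... | _ | no x≰L+r = begin
  x * p                      ≤⟨ *-monoˡ-≤ p (≤-trans x≤ (≤-reflexive (length-ext w r))) ⟩
  p + (length w + r) * p     ≤⟨ +-mono-≤ p≤q bound ⟩
  q + ones w * q             ≡⟨ cong (_* q) (P-ext-> w r (≰⇒> x≰L+r)) ⟨
  P (ext w r) x * q          ∎
  where open ≤-Reasoning

search≡firstFrom : ∀ w j fuel → search w j fuel ≡ firstFrom (λ r → isPrefixNormal (ext w r)) j fuel
search≡firstFrom w j zero       = refl
search≡firstFrom w j (suc fuel) with isPrefixNormal (ext w j)
... | true  = refl
... | false = search≡firstFrom w (suc j) fuel

gap : FinWord → ℕ
gap w = search w 0 (suc (length w))

gap-isFirst : ∀ {w} → PrefixNormal w → StartsWithOne w →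
  IsFirstFrom (λ r → isPrefixNormal (ext w r)) 0 (gap w)
gap-isFirst {w} pn h = subst (IsFirstFrom _ 0) (sym (search≡firstFrom w 0 (suc (length w))))
  (firstFrom-isFirst _ 0 (suc (length w)) (length w) ≤-refl
    (isPrefixNormal-complete _ (ext-prefixNormal-long (length w) pn h ≤-refl)))

gap-bound : ∀ {p q w} → PrefixNormal w → StartsWithOne w → Dense p q w →
  (length w + gap w) * p ≤ ones w * q
gap-bound {p} {q} {w} pn h d with gap w | gap-isFirst pn h
... | zero  | _     = begin
  (length w + 0) * p   ≡⟨ cong (_* p) (+-identityʳ (length w)) ⟩
  length w * p         ≤⟨ d (length w) ≤-refl ⟩
  P w (length w) * q   ≡⟨ cong (_* q) (P-all w ≤-refl) ⟩
  ones w * q           ∎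
  where open ≤-Reasoning
... | suc r | first = ≮⇒≥ λ sparse → IsFirstFrom.minimal first r z≤n ≤-refl
  (isPrefixNormal-complete _ (ext-prefixNormal-sparse r pn h d sparse))

record Admissible (p q : ℕ) (w : FinWord) : Set where
  field
    prefixNormal : PrefixNormal w
    startsWithOne : StartsWithOne w
    dense : Dense p q w

length-nonZero : ∀ {p q w} → Admissible p q w → ℕ.NonZero (length w)
length-nonZero adm = ℕ.>-nonZero (1≤length (Admissible.startsWithOne adm))

flipext-admissible : ∀ {p q w} → p ≤ q → Admissible p q w → Admissible p q (flipext w)
flipext-admissible p≤q adm = record
  { prefixNormal = isPrefixNormal-sound _ (IsFirstFrom.holds (gap-isFirst prefixNormal startsWithOne))
  ; startsWithOne = startsWithOne-++ _ startsWithOne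
  ; dense = Dense-ext _ p≤q dense (gap-bound prefixNormal startsWithOne dense) }
  where open Admissible adm

flipextIter-admissible : ∀ {p q w} n → p ≤ q → Admissible p q w → Admissible p q (flipextIter n w)
flipextIter-admissible zero    p≤q adm = adm
flipextIter-admissible (suc n) p≤q adm = flipext-admissible p≤q (flipextIter-admissible n p≤q adm)

length-flipextIter : ∀ w n → length w + n ≤ length (flipextIter n w)
length-flipextIter w zero    = ≤-reflexive (+-identityʳ _)
length-flipextIter w (suc n) = begin
  length w + suc n                                 ≡⟨ +-suc (length w) n ⟩
  suc (length w + n)                               ≤⟨ s≤s (length-flipextIter w n) ⟩
  suc (length (flipextIter n w))                   ≤⟨ s≤s (m≤m+n _ _) ⟩
  suc (length (flipextIter n w) + gap (flipextIter n w)) ≡⟨ length-ext (flipextIter n w) _ ⟨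
  length (flipextIter (suc n) w)                   ∎
  where open ≤-Reasoning

flipextIter-≼ : ∀ w {m n} → m ≤ n → flipextIter m w ≼ flipextIter n w
flipextIter-≼ w {m} {zero}  z≤n = ≼-refl
flipextIter-≼ w {m} {suc n} m≤ with m≤n⇒m<n∨m≡n m≤
... | inj₁ m<  = ≼-trans (flipextIter-≼ w (s≤s⁻¹ m<)) (≼-++ _ _)
... | inj₂ refl = ≼-refl

prefω-flipextω : ∀ {w} → 1 ≤ length w → ∀ N → prefω (flipextω w) N ≡ take N (flipextIter N w)
prefω-flipextω {w} 1≤L N = prefω-nth _ _ agree (≤-trans (m≤n+m N (length w)) (length-flipextIter w N))
  where
  agree : ∀ k → k < N → flipextω w k ≡ nth (flipextIter N w) k
  agree k k<N = sym (nth-≼ (flipextIter-≼ w (<⇒≤ k<N))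
    (≤-trans (+-monoˡ-≤ k 1≤L) (length-flipextIter w k)))

-- One step of the construction

step : FinWord → ℕ → ℕ → FinWord
step V k ℓ = prefω (flipextω V) (k * length V) ++ replicate ℓ false

module _ {V : FinWord} (adm : Admissible (ones V) (length V) V) {k : ℕ} (1≤k : 1 ≤ k) (ℓ : ℕ) where

  private
    N = length V
    O = ones V
    F = flipextIter (k * N) V
    Pfx = take (k * N) F

    instance
      k≢0 : ℕ.NonZero k
      k≢0 = ℕ.>-nonZero 1≤k
      N≢0 : ℕ.NonZero N
      N≢0 = length-nonZero adm

    F-adm : Admissible O N F
    F-adm = flipextIter-admissible (k * N) (ones≤length V) adm

    V≼F : V ≼ F
    V≼F = flipextIter-≼ V {0} {k * N} z≤n

    N≤kN : N ≤ k * N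
    N≤kN = m≤n*m N k

    kN≤|F| : k * N ≤ length F
    kN≤|F| = ≤-trans (m≤n+m (k * N) N) (length-flipextIter V (k * N))

    P-F-N : P F N ≡ O
    P-F-N = trans (P-≼ V≼F ≤-refl) (P-all V ≤-refl)

    -- subadditivity bounds the ones of the prefix above, density below
    ones-Pfx : ones Pfx ≡ k * O
    ones-Pfx = ≤-antisym
      (≤-trans (P-*≤ (prefixNormal⇒subadditive (Admissible.prefixNormal F-adm)) k N) (≤-reflexive (cong (k *_) P-F-N)))
      (*-cancelʳ-≤ (k * O) (P F (k * N)) N (begin
        k * O * N         ≡⟨ xy∙z≈xz∙y k O N ⟩
        k * N * O         ≤⟨ Admissible.dense F-adm (k * N) kN≤|F| ⟩
        P F (k * N) * N   ∎))
      where open ≤-Reasoning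

    length-Pfx : length Pfx ≡ k * N
    length-Pfx = trans (length-take (k * N) F) (m≤n⇒m⊓n≡m kN≤|F|)

    step≡ : step V k ℓ ≡ Pfx ++ replicate ℓ false
    step≡ = cong (_++ replicate ℓ false) (prefω-flipextω (1≤length (Admissible.startsWithOne adm)) (k * N))

    Pfx-adm : Admissible (ones Pfx) (length Pfx) Pfx
    Pfx-adm = record
      { prefixNormal = subadditive⇒prefixNormal
          (subadditive-take (k * N) (prefixNormal⇒subadditive (Admissible.prefixNormal F-adm)))
      ; startsWithOne = startsWithOne-take (k * N)
          (≤-trans (1≤length (Admissible.startsWithOne adm)) N≤kN) (Admissible.startsWithOne F-adm)
      ; dense = subst₂ (λ p q → Dense p q Pfx) (sym ones-Pfx) (sym length-Pfx)
          (Dense-scale k (Dense-take (k * N) (Admissible.dense F-adm))) }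

  length-step : length (step V k ℓ) ≡ k * length V + ℓ
  length-step = trans (cong length step≡) (trans (length-++ Pfx) (cong₂ _+_ length-Pfx (length-replicate ℓ)))

  ones-step : ones (step V k ℓ) ≡ k * ones V
  ones-step = trans (cong ones step≡) (trans (ones-++ Pfx _) (trans (cong₂ _+_ ones-Pfx (ones-zeros ℓ)) (+-identityʳ _)))

  ≼-step : V ≼ step V k ℓ
  ≼-step = subst (V ≼_) (sym step≡) (≼-trans (≼-take (k * N) V≼F N≤kN) (≼-++ Pfx _))

  step-admissible : Admissible (ones (step V k ℓ)) (length (step V k ℓ)) (step V k ℓ)
  step-admissible = subst (λ w → Admissible (ones w) (length w) w) (sym step≡) (record
    { prefixNormal = subadditive⇒prefixNormal
        (subadditive-++-zeros ℓ (prefixNormal⇒subadditive (Admissible.prefixNormal Pfx-adm)))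
    ; startsWithOne = startsWithOne-++ _ (Admissible.startsWithOne Pfx-adm)
    ; dense = Dense-++-zeros ℓ (Admissible.dense Pfx-adm) })

-- Eventually periodic words

periodicWord-tail : ∀ x b us {p} → length x ≤ p →
  periodicWord x b us p ≡ nth (b ∷ us) ((p ∸ length x) % suc (length us))
periodicWord-tail x b us {p} |x|≤p with suc p ≤ᵇ length x in eq
... | true  = ⊥-elim (<⇒≱ (≤ᵇ⇒≤ (suc p) (length x) (subst T (sym eq) tt)) |x|≤p)
... | false = refl

periodic-one-in-window : ∀ {v : InfWord} {x b us t} → (∀ p → v p ≡ periodicWord x b us p) →
  t < suc (length us) → nth (b ∷ us) t ≡ true →
  ∀ s → ∃ λ p → s ≤ p × p < s + (length x + 2 * suc (length us)) × v p ≡ true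
periodic-one-in-window {v} {x} {b} {us} {t} periodic t<U one s = p , s≤p , p< , vp
  where
  U = suc (length us)
  q = s / U
  p = length x + (t + suc q * U)
  s≤p : s ≤ p
  s≤p = begin
    s                   ≤⟨ <⇒≤ (proj₂ (div-bounds s U)) ⟩
    suc q * U           ≤⟨ m≤n+m (suc q * U) t ⟩
    t + suc q * U       ≤⟨ m≤n+m _ (length x) ⟩
    p                   ∎
    where open ≤-Reasoning
  shuffle : ∀ x U s → x + (U + (U + s)) ≡ s + (x + 2 * U)
  shuffle = ℕ-solve-∀
  p< : p < s + (length x + 2 * U)
  p< = begin-strict
    length x + (t + (U + q * U))   <⟨ +-monoʳ-< (length x) (+-monoˡ-< (U + q * U) t<U) ⟩
    length x + (U + (U + q * U))   ≤⟨ +-monoʳ-≤ (length x) (+-monoʳ-≤ U (+-monoʳ-≤ U (proj₁ (div-bounds s U)))) ⟩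
    length x + (U + (U + s))       ≡⟨ shuffle (length x) U s ⟩
    s + (length x + 2 * U)         ∎
    where open ≤-Reasoning
  vp : v p ≡ true
  vp = begin
    v p                                              ≡⟨ periodic p ⟩
    periodicWord x b us p                            ≡⟨ periodicWord-tail x b us (m≤m+n (length x) _) ⟩
    nth (b ∷ us) ((p ∸ length x) % U)                ≡⟨ cong (λ y → nth (b ∷ us) (y % U)) (m+n∸m≡n (length x) _) ⟩
    nth (b ∷ us) ((t + suc q * U) % U)               ≡⟨ cong (nth (b ∷ us)) ([m+kn]%n≡m%n t (suc q) U) ⟩
    nth (b ∷ us) (t % U)                             ≡⟨ cong (nth (b ∷ us)) (m<n⇒m%n≡m t<U) ⟩
    nth (b ∷ us) t                                   ≡⟨ one ⟩
    true                                             ∎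
    where open ≡-Reasoning

-- Rational arithmetic
-- A rational p is handled through toℚᵘ p ≃ mkℚᵘ i d, i.e. p = i / (1 + d), where sums and
-- products are plain cross-multiplications without gcd normalisation.

floor-spec : ∀ p → ℚ.floor p ℤ.* ↧ p ℤ.≤ ↥ p × ↥ p ℤ.< ℤ.suc (ℚ.floor p) ℤ.* ↧ p
floor-spec (mkℚ n d-1 _) = ℤD.[n/d]*d≤n n (+ suc d-1) ,
  subst (λ q → n ℤ.< ℤ.suc q ℤ.* + suc d-1) (sym (ℤD.div-pos-is-/ℕ n (suc d-1))) (ℤD.n<s[n/ℕd]*d n (suc d-1))

floor-bounds : ∀ p {i d} → toℚᵘ p ℚᵘ.≃ mkℚᵘ i d →
  ℚ.floor p ℤ.* + suc d ℤ.≤ i × i ℤ.< ℤ.suc (ℚ.floor p) ℤ.* + suc d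
floor-bounds p@(mkℚ _ _ _) {i} {d} (*≡* eq) =
  ℤP.*-cancelʳ-≤-pos _ _ (↧ p) (begin
    ℚ.floor p ℤ.* D ℤ.* ↧ p           ≡⟨ ℤ*.xy∙z≈xz∙y (ℚ.floor p) D (↧ p) ⟩
    ℚ.floor p ℤ.* ↧ p ℤ.* D           ≤⟨ ℤP.*-monoʳ-≤-nonNeg D (proj₁ (floor-spec p)) ⟩
    ↥ p ℤ.* D                         ≡⟨ eq ⟩
    i ℤ.* ↧ p                         ∎) ,
  ℤP.*-cancelʳ-<-nonNeg (↧ p) (begin-strict
    i ℤ.* ↧ p                         ≡⟨ eq ⟨
    ↥ p ℤ.* D                         <⟨ ℤP.*-monoʳ-<-pos D (proj₂ (floor-spec p)) ⟩
    ℤ.suc (ℚ.floor p) ℤ.* ↧ p ℤ.* D   ≡⟨ ℤ*.xy∙z≈xz∙y (ℤ.suc (ℚ.floor p)) (↧ p) D ⟩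
    ℤ.suc (ℚ.floor p) ℤ.* D ℤ.* ↧ p   ∎)
  where
  open ℤP.≤-Reasoning
  D = + suc d

quotient-≤ : ∀ {x y m} d → x ℤ.* + suc d ℤ.≤ m → m ℤ.< ℤ.suc y ℤ.* + suc d → x ℤ.≤ y
quotient-≤ {x} {y} d xD≤m m<yD = subst (x ℤ.≤_) (ℤP.pred-suc y)
  (ℤP.i<j⇒i≤pred[j] (ℤP.*-cancelʳ-<-nonNeg {j = ℤ.suc y} (+ suc d) (ℤP.≤-<-trans xD≤m m<yD)))

floor-nat : ∀ p {M d} → toℚᵘ p ℚᵘ.≃ mkℚᵘ (+ M) d → ℚ.floor p ≡ + (M / suc d)
floor-nat p {M} {d} p≃ = ℤP.≤-antisym
  (quotient-≤ d (proj₁ (floor-bounds p p≃))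
    (subst (+ M ℤ.<_) (ℤP.pos-* (suc (M / suc d)) (suc d)) (+<+ (proj₂ (div-bounds M (suc d))))))
  (quotient-≤ d
    (subst (ℤ._≤ + M) (ℤP.pos-* (M / suc d) (suc d)) (+≤+ (proj₁ (div-bounds M (suc d)))))
    (proj₂ (floor-bounds p p≃)))

ceiling-bound : ∀ p {i d} → toℚᵘ p ℚᵘ.≃ mkℚᵘ i d → i ℤ.≤ ℚ.ceiling p ℤ.* + suc d
ceiling-bound p@(mkℚ _ _ _) {i} {d} p≃ = begin
  i                                   ≡⟨ ℤP.neg-involutive i ⟨
  ℤ.- (ℤ.- i)                         ≤⟨ ℤP.neg-mono-≤ (proj₁ (floor-bounds (ℚ.- p) -p≃)) ⟩
  ℤ.- (ℚ.floor (ℚ.- p) ℤ.* + suc d)   ≡⟨ ℤP.neg-distribˡ-* (ℚ.floor (ℚ.- p)) (+ suc d) ⟩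
  ℚ.ceiling p ℤ.* + suc d             ∎
  where
  open ℤP.≤-Reasoning
  -p≃ : toℚᵘ (ℚ.- p) ℚᵘ.≃ mkℚᵘ (ℤ.- i) d
  -p≃ = ℚᵘP.≃-trans (ℚP.toℚᵘ-homo‿- p) (ℚᵘP.-‿cong p≃)

toℚᵘ-toℚ : ∀ m → toℚᵘ (toℚ m) ℚᵘ.≃ mkℚᵘ (+ m) 0
toℚᵘ-toℚ m = ℚP.toℚᵘ-fromℚᵘ (mkℚᵘ (+ m) 0)

num : ℚ → ℕ
num q = ℤ.∣ ↥ q ∣

toℚᵘ-positive : ∀ {q} → 0ℚ ℚ.< q → toℚᵘ q ≡ mkℚᵘ (+ num q) (ℚ.ℚ.denominator-1 q)
toℚᵘ-positive {mkℚ (+ n)    _ _} _        = refl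
toℚᵘ-positive {mkℚ -[1+ n ] _ _} (*<* ())

num-nonZero : ∀ {q} → 0ℚ ℚ.< q → ℕ.NonZero (num q)
num-nonZero {mkℚ (+ suc n) _ _} _ = _
num-nonZero {mkℚ (+ zero)  _ _} (*<* (+<+ ()))
num-nonZero {mkℚ -[1+ n ]  _ _} (*<* ())

fraction-≤ : ∀ {p q a b c d} → toℚᵘ p ℚᵘ.≃ mkℚᵘ (+ a) b → toℚᵘ q ℚᵘ.≃ mkℚᵘ (+ c) d →
  a * suc d ≤ c * suc b → p ℚ.≤ q
fraction-≤ {a = a} {b} {c} {d} p≃ q≃ h = ℚP.toℚᵘ-cancel-≤
  (ℚᵘP.≤-respˡ-≃ (ℚᵘP.≃-sym p≃) (ℚᵘP.≤-respʳ-≃ (ℚᵘP.≃-sym q≃)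
    (ℚᵘ.*≤* (subst₂ ℤ._≤_ (ℤP.pos-* a (suc d)) (ℤP.pos-* c (suc b)) (+≤+ h)))))

fraction-< : ∀ {p q a b c d} → toℚᵘ p ℚᵘ.≃ mkℚᵘ (+ a) b → toℚᵘ q ℚᵘ.≃ mkℚᵘ (+ c) d →
  a * suc d < c * suc b → p ℚ.< q
fraction-< {a = a} {b} {c} {d} p≃ q≃ h = ℚP.toℚᵘ-cancel-<
  (ℚᵘP.<-respˡ-≃ (ℚᵘP.≃-sym p≃) (ℚᵘP.<-respʳ-≃ (ℚᵘP.≃-sym q≃)
    (ℚᵘ.*<* (subst₂ ℤ._<_ (ℤP.pos-* a (suc d)) (ℤP.pos-* c (suc b)) (+<+ h)))))

fraction-<⁻ : ∀ {p q a b c d} → toℚᵘ p ℚᵘ.≃ mkℚᵘ (+ a) b → toℚᵘ q ℚᵘ.≃ mkℚᵘ (+ c) d →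
  p ℚ.< q → a * suc d < c * suc b
fraction-<⁻ {a = a} {b} {c} {d} p≃ q≃ p<q with ℚᵘP.<-respˡ-≃ p≃ (ℚᵘP.<-respʳ-≃ q≃ (ℚP.toℚᵘ-mono-< p<q))
... | ℚᵘ.*<* h = ℤP.drop‿+<+ (subst₂ ℤ._<_ (sym (ℤP.pos-* a (suc d))) (sym (ℤP.pos-* c (suc b))) h)

fraction-+ : ∀ {p q a b c d} → toℚᵘ p ℚᵘ.≃ mkℚᵘ (+ a) b → toℚᵘ q ℚᵘ.≃ mkℚᵘ (+ c) d →
  toℚᵘ (p ℚ.+ q) ℚᵘ.≃ mkℚᵘ (+ (a * suc d + c * suc b)) (ℕ.pred (suc b * suc d))
fraction-+ {p} {q} {a} {b} {c} {d} p≃ q≃ =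
  ℚᵘP.≃-trans (ℚP.toℚᵘ-homo-+ p q) (ℚᵘP.≃-trans (ℚᵘP.+-cong p≃ q≃) (*≡* (cong (ℤ._* + (suc b * suc d))
    (sym (trans (ℤP.pos-+ (a * suc d) (c * suc b)) (cong₂ ℤ._+_ (ℤP.pos-* a (suc d)) (ℤP.pos-* c (suc b))))))))

+m≤z*d⇒m≤∣z∣*d : ∀ {m d} z → + m ℤ.≤ z ℤ.* + suc d → m ≤ ℤ.∣ z ∣ * suc d
+m≤z*d⇒m≤∣z∣*d {m} {d} (+ c) h = ℤP.drop‿+≤+ (subst (+ m ℤ.≤_) (sym (ℤP.pos-* c (suc d))) h)
+m≤z*d⇒m≤∣z∣*d -[1+ c ] ()

c₁-bound : ∀ a → 0ℚ ℚ.< a 0 → 10 * num (a 0) ≤ c₁ a * ↧ₙ (a 0)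
c₁-bound a a₀>0 = +m≤z*d⇒m≤∣z∣*d (ℚ.ceiling p) (ceiling-bound p p≃)
  where
  p = toℚ 10 ℚ.* a 0
  d = ℚ.ℚ.denominator-1 (a 0)
  p≃ : toℚᵘ p ℚᵘ.≃ mkℚᵘ (+ (10 * num (a 0))) d
  p≃ = ℚᵘP.≃-trans (ℚP.toℚᵘ-homo-* (toℚ 10) (a 0))
    (ℚᵘP.≃-trans (ℚᵘP.*-cong (toℚᵘ-toℚ 10) (ℚᵘP.≃-reflexive (toℚᵘ-positive a₀>0)))
      (*≡* (cong₂ ℤ._*_ (sym (ℤP.pos-* 10 (num (a 0)))) (cong +_ (sym (*-identityˡ (suc d)))))))

-- k (O − a N) (1/a) for a = (1+n)/(1+d), evaluated in ℚᵘ, where nothing is normalised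
ℓformᵘ : ℕ → ℕ → ℕ → ℕ → ℕ → ℚᵘ
ℓformᵘ n d O N k =
  mkℚᵘ (+ k) 0 ℚᵘ.* ((mkℚᵘ (+ O) 0 ℚᵘ.- mkℚᵘ (+ suc n) d ℚᵘ.* mkℚᵘ (+ N) 0) ℚᵘ.* mkℚᵘ (+ suc d) n)

toℚᵘ-ℓform-argument : ∀ n d .(c : Coprime (suc n) (suc d)) O N k → let a = mkℚ (+ suc n) d c in
  toℚᵘ (toℚ k ℚ.* ((toℚ O ℚ.- a ℚ.* toℚ N) ℚ.* inv a)) ℚᵘ.≃ ℓformᵘ n d O N k
toℚᵘ-ℓform-argument n d c O N k =
  ℚᵘP.≃-trans (ℚP.toℚᵘ-homo-* (toℚ k) ((toℚ O ℚ.- a ℚ.* toℚ N) ℚ.* inv a)) (ℚᵘP.*-cong (toℚᵘ-toℚ k)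
    (ℚᵘP.≃-trans (ℚP.toℚᵘ-homo-* (toℚ O ℚ.- a ℚ.* toℚ N) (inv a)) (ℚᵘP.*-congʳ difference)))
  where
  a = mkℚ (+ suc n) d c
  difference : toℚᵘ (toℚ O ℚ.- a ℚ.* toℚ N) ℚᵘ.≃
               mkℚᵘ (+ O) 0 ℚᵘ.- mkℚᵘ (+ suc n) d ℚᵘ.* mkℚᵘ (+ N) 0
  difference = ℚᵘP.≃-trans (ℚP.toℚᵘ-homo-+ (toℚ O) (ℚ.- (a ℚ.* toℚ N))) (ℚᵘP.+-cong (toℚᵘ-toℚ O)
    (ℚᵘP.≃-trans (ℚP.toℚᵘ-homo‿- (a ℚ.* toℚ N)) (ℚᵘP.-‿cong
      (ℚᵘP.≃-trans (ℚP.toℚᵘ-homo-* a (toℚ N)) (ℚᵘP.*-congˡ {mkℚᵘ (+ suc n) d} (toℚᵘ-toℚ N))))))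

ℓformᵘ≃ : ∀ n d O N k → suc n * N ≤ O * suc d →
  ℓformᵘ n d O N k ℚᵘ.≃ mkℚᵘ (+ (k * (O * suc d ∸ suc n * N))) n
ℓformᵘ≃ n d O N k le = *≡* (begin
  + k ℤ.* ((+ O ℤ.* + (suc d * 1) ℤ.+ ℤ.- (+ suc n ℤ.* + N) ℤ.* + 1) ℤ.* + suc d) ℤ.* + suc n
    ≡⟨ cong (λ x → + k ℤ.* ((+ O ℤ.* + x ℤ.+ ℤ.- (+ suc n ℤ.* + N) ℤ.* + 1) ℤ.* + suc d) ℤ.* + suc n)
            (*-identityʳ (suc d)) ⟩
  + k ℤ.* ((+ O ℤ.* + suc d ℤ.+ ℤ.- (+ suc n ℤ.* + N) ℤ.* + 1) ℤ.* + suc d) ℤ.* + suc n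
    ≡⟨ rearrange (+ k) (+ O) (+ suc d) (+ suc n) (+ N) ⟩
  + k ℤ.* (+ O ℤ.* + suc d ℤ.- + suc n ℤ.* + N) ℤ.* (+ suc d ℤ.* + suc n)
    ≡⟨ cong₂ ℤ._*_ (sym +M≡) (sym (trans (cong +_ denominator) (ℤP.pos-* (suc d) (suc n)))) ⟩
  + M ℤ.* + (1 * ((1 * (suc d * 1)) * suc n)) ∎)
  where
  open ≡-Reasoning
  M = k * (O * suc d ∸ suc n * N)
  rearrange : ∀ K O D S N → K ℤ.* ((O ℤ.* D ℤ.+ ℤ.- (S ℤ.* N) ℤ.* + 1) ℤ.* D) ℤ.* S
                          ≡ K ℤ.* (O ℤ.* D ℤ.- S ℤ.* N) ℤ.* (D ℤ.* S)
  rearrange = ℤ-solve-∀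
  +M≡ : + M ≡ + k ℤ.* (+ O ℤ.* + suc d ℤ.- + suc n ℤ.* + N)
  +M≡ = begin
    + M                                            ≡⟨ ℤP.pos-* k _ ⟩
    + k ℤ.* + (O * suc d ∸ suc n * N)
      ≡⟨ cong (+ k ℤ.*_) (trans (sym (ℤP.⊖-≥ le)) (sym (ℤP.m-n≡m⊖n (O * suc d) (suc n * N)))) ⟩
    + k ℤ.* (+ (O * suc d) ℤ.- + (suc n * N))
      ≡⟨ cong₂ (λ x y → + k ℤ.* (x ℤ.- y)) (ℤP.pos-* O (suc d)) (ℤP.pos-* (suc n) N) ⟩
    + k ℤ.* (+ O ℤ.* + suc d ℤ.- + suc n ℤ.* + N)  ∎
  denominator : 1 * ((1 * (suc d * 1)) * suc n) ≡ suc d * suc n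
  denominator = trans (*-identityˡ _) (cong (_* suc n) (trans (*-identityˡ _) (*-identityʳ (suc d))))

ℓform≡ : ∀ {a} → 0ℚ ℚ.< a → ∀ w k .{{_ : ℕ.NonZero (num a)}} →
  num a * length w ≤ ones w * ↧ₙ a →
  ℓform a w k ≡ + (k * (ones w * ↧ₙ a ∸ num a * length w) / num a)
ℓform≡ {mkℚ -[1+ _ ] _ _} (*<* ())
ℓform≡ {mkℚ (+ zero) _ _} (*<* (+<+ ()))
ℓform≡ {a@(mkℚ (+ suc n) d c)} _ w k le = floor-nat _ {d = n}
  (ℚᵘP.≃-trans (toℚᵘ-ℓform-argument n d c (ones w) (length w) k) (ℓformᵘ≃ n d (ones w) (length w) k le))

-- The construction

module Build (a : ℕ → ℚ) (a>0 : ∀ i → 0ℚ ℚ.< a i) (a<1 : ∀ i → a i ℚ.< 1ℚ)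
             (a↓ : ∀ i → a (suc i) ℚ.< a i) where

  n d : ℕ → ℕ
  n i = num (a i)
  d i = ↧ₙ (a i)

  instance
    n≢0 : ∀ {i} → ℕ.NonZero (n i)
    n≢0 {i} = num-nonZero (a>0 i)

  a≃ : ∀ i → toℚᵘ (a i) ℚᵘ.≃ mkℚᵘ (+ n i) (ℚ.ℚ.denominator-1 (a i))
  a≃ i = ℚᵘP.≃-reflexive (toℚᵘ-positive (a>0 i))

  n<d : ∀ i → n i < d i
  n<d i = subst₂ _<_ (*-identityʳ (n i)) (*-identityˡ (d i))
    (fraction-<⁻ (a≃ i) (ℚᵘP.≃-refl {mkℚᵘ (+ 1) 0}) (a<1 i))

  a-antitone : ∀ {i j} → i < j → a j ℚ.< a i
  a-antitone {i} {suc j} i<1+j with m≤n⇒m<n∨m≡n (s≤s⁻¹ i<1+j)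
  ... | inj₁ i<j  = ℚP.<-trans (a↓ j) (a-antitone i<j)
  ... | inj₂ refl = a↓ i

  cross-antitone : ∀ {i j} → i < j → n j * d i < n i * d j
  cross-antitone i<j = fraction-<⁻ (a≃ _) (a≃ _) (a-antitone i<j)

  record Invariant (i : ℕ) (V : FinWord) : Set where
    field
      admissible : Admissible (ones V) (length V) V
      dense : n i * length V ≤ ones V * d i
      many-ones : i < ones V

  Δ : ℕ → FinWord → ℕ
  Δ i V = ones V * d (suc i) ∸ n (suc i) * length V

  ℓ : ℕ → FinWord → ℕ → ℕ
  ℓ i V k = k * Δ i V / n (suc i)

  module _ {i V} (I : Invariant i V) where

    open Invariant I

    private instance
      |V|≢0 : ℕ.NonZero (length V)
      |V|≢0 = length-nonZero admissible

    denser-than-next : n (suc i) * length V < ones V * d (suc i)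
    denser-than-next = cross-<-≤-trans {n (suc i)} {d (suc i)} {n i} {d i} {ones V} {length V}
      (cross-antitone {i} {suc i} ≤-refl) dense

    ℓform≡ℓ : ∀ k → ℓform (a (suc i)) V k ≡ + ℓ i V k
    ℓform≡ℓ k = ℓform≡ (a>0 (suc i)) V k (<⇒≤ denser-than-next)

    1≤Δ : 1 ≤ Δ i V
    1≤Δ = m<n⇒0<n∸m denser-than-next

    invariant-step : ∀ {k} → 2 ≤ k → Invariant (suc i) (step V k (ℓ i V k))
    invariant-step {k} 2≤k = record
      { admissible = step-admissible admissible 1≤k ℓ′
      ; dense = subst₂ (λ N′ O′ → n′ * N′ ≤ O′ * d′)
          (sym (length-step admissible 1≤k ℓ′)) (sym (ones-step admissible 1≤k ℓ′)) dense′
      ; many-ones = subst (suc i <_) (sym (ones-step admissible 1≤k ℓ′)) many-ones′ }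
      where
      open ≤-Reasoning
      1≤k : 1 ≤ k
      1≤k = ≤-trans (s≤s z≤n) 2≤k
      ℓ′ = ℓ i V k
      n′ = n (suc i)
      d′ = d (suc i)
      N = length V
      O = ones V
      ℓn′≤kΔ : n′ * ℓ′ ≤ k * Δ i V
      ℓn′≤kΔ = ≤-trans (≤-reflexive (*-comm n′ ℓ′)) (m/n*n≤m (k * Δ i V) n′)
      dense′ : n′ * (k * N + ℓ′) ≤ k * O * d′
      dense′ = begin
        n′ * (k * N + ℓ′)           ≡⟨ *-distribˡ-+ n′ (k * N) ℓ′ ⟩
        n′ * (k * N) + n′ * ℓ′      ≤⟨ +-monoʳ-≤ (n′ * (k * N)) ℓn′≤kΔ ⟩
        n′ * (k * N) + k * Δ i V    ≡⟨ cong (_+ k * Δ i V) (x∙yz≈y∙xz n′ k N) ⟩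
        k * (n′ * N) + k * Δ i V    ≡⟨ *-distribˡ-+ k (n′ * N) (Δ i V) ⟨
        k * (n′ * N + Δ i V)        ≡⟨ cong (k *_) (m+[n∸m]≡n (<⇒≤ denser-than-next)) ⟩
        k * (O * d′)                ≡⟨ *-assoc k O d′ ⟨
        k * O * d′                  ∎
      many-ones′ : suc i < k * O
      many-ones′ = begin-strict
        suc i          ≤⟨ many-ones ⟩
        O              <⟨ m<m+n O (≤-trans (s≤s z≤n) many-ones) ⟩
        O + O          ≡⟨ cong (_+_ O) (+-identityʳ O) ⟨
        2 * O          ≤⟨ *-monoˡ-≤ O 2≤k ⟩
        k * O          ∎

  1≤c₁ : 1 ≤ c₁ a
  1≤c₁ with c₁ a | c₁-bound a (a>0 0)
  ... | zero  | 10n≤0 = ⊥-elim (n≮0 (≤-trans (*-monoʳ-≤ 10 (ℕ.>-nonZero⁻¹ (n 0))) 10n≤0))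
  ... | suc _ | _     = s≤s z≤n

  V₀ : FinWord
  V₀ = replicate (c₁ a) true ++ replicate (10 ∸ c₁ a) false

  V₀-invariant : Invariant 0 V₀
  V₀-invariant = record
    { admissible = record
      { prefixNormal = subadditive⇒prefixNormal (subadditive-++-zeros (10 ∸ c) (subadditive-replicate-true c))
      ; startsWithOne = startsWithOne-++ _ (startsWithOne-replicate 1≤c₁)
      ; dense = Dense-++-zeros (10 ∸ c) (Dense-replicate-true c) }
    ; dense = subst₂ (λ N O → n 0 * N ≤ O * d 0) (sym length-V₀) (sym ones-V₀) dense₀
    ; many-ones = subst (0 <_) (sym ones-V₀) 1≤c₁ }
    where
    c = c₁ a
    length-V₀ : length V₀ ≡ c + (10 ∸ c)
    length-V₀ = trans (length-++ (replicate c true)) (cong₂ _+_ (length-replicate c) (length-replicate (10 ∸ c)))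
    ones-V₀ : ones V₀ ≡ c
    ones-V₀ = trans (ones-++ (replicate c true) _)
      (trans (cong₂ _+_ (ones-replicate-true c) (ones-zeros (10 ∸ c))) (+-identityʳ c))
    dense₀ : n 0 * (c + (10 ∸ c)) ≤ c * d 0
    dense₀ with c ≤? 10
    ... | yes c≤10 =
      ≤-trans (≤-reflexive (trans (cong (n 0 *_) (m+[n∸m]≡n c≤10)) (*-comm (n 0) 10))) (c₁-bound a (a>0 0))
    ... | no c≰10  = begin
      n 0 * (c + (10 ∸ c))  ≡⟨ cong (λ m → n 0 * (c + m)) (m≤n⇒m∸n≡0 (<⇒≤ (≰⇒> c≰10))) ⟩
      n 0 * (c + 0)         ≡⟨ cong (n 0 *_) (+-identityʳ c) ⟩
      n 0 * c               ≤⟨ *-monoˡ-≤ c (<⇒≤ (n<d 0)) ⟩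
      d 0 * c               ≡⟨ *-comm (d 0) c ⟩
      c * d 0               ∎
      where open ≤-Reasoning

  exceeds : ℕ → FinWord → ℕ → ℕ → Bool
  exceeds i V L k = L ℕ.<ᵇ ℓ i V k

  -- the fuel suffices: ℓ i V (2 + (L + 1) · n (suc i)) > L because Δ i V ≥ 1
  nextK : ℕ → FinWord → ℕ → ℕ
  nextK i V L = firstFrom (exceeds i V L) 2 (suc (suc L * n (suc i)))

  nextK-isFirst : ∀ {i V} L → Invariant i V → IsFirstFrom (exceeds i V L) 2 (nextK i V L)
  nextK-isFirst {i} {V} L I = firstFrom-isFirst _ 2 _ t ≤-refl (<⇒<ᵇ L<ℓ)
    where
    open ≤-Reasoning
    t = suc L * n (suc i)
    L<ℓ : L < ℓ i V (2 + t)
    L<ℓ = begin-strict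
      L                          <⟨ n<1+n L ⟩
      suc L                      ≡⟨ m*n/n≡m (suc L) (n (suc i)) ⟨
      t / n (suc i)              ≤⟨ /-monoˡ-≤ (n (suc i)) (begin
        t                           ≡⟨ *-identityʳ t ⟨
        t * 1                       ≤⟨ *-monoʳ-≤ t (1≤Δ I) ⟩
        t * Δ i V                   ≤⟨ *-monoˡ-≤ (Δ i V) (m≤n+m t 2) ⟩
        (2 + t) * Δ i V             ∎) ⟩
      ℓ i V (2 + t)              ∎

  next : ℕ → FinWord × ℕ → FinWord × ℕ
  next i (V , L) = step V (nextK i V L) (ℓ i V (nextK i V L)) , ℓ i V (nextK i V L)

  build : ℕ → FinWord × ℕ
  build zero    = V₀ , 10 ∸ c₁ a
  build (suc i) = next i (build i)

  built-V : ℕ → FinWord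
  built-V i = proj₁ (build i)

  built-L : ℕ → ℕ
  built-L i = proj₂ (build i)

  built-K : ℕ → ℕ
  built-K zero    = 0
  built-K (suc i) = nextK i (built-V i) (built-L i)

  built-invariant : ∀ i → Invariant i (built-V i)
  built-invariant zero    = V₀-invariant
  built-invariant (suc i) = invariant-step (built-invariant i)
    (IsFirstFrom.start≤ (nextK-isFirst (built-L i) (built-invariant i)))

  existence : ∃ λ V → ∃ λ L → ∃ λ K → Construction a V L K
  existence = built-V , built-L , built-K , refl , refl , stage
    where
    stage : ∀ i → (2 ≤ built-K (suc i)) ×
      (+ built-L (suc i) ≡ ℓform (a (suc i)) (built-V i) (built-K (suc i))) ×
      (built-L i < built-L (suc i)) ×
      (∀ k → 2 ≤ k → k < built-K (suc i) → ℓform (a (suc i)) (built-V i) k ℤ.≤ + built-L i) ×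
      (built-V (suc i) ≡ step (built-V i) (built-K (suc i)) (built-L (suc i)))
    stage i = start≤ , sym (ℓform≡ℓ I (built-K (suc i))) , <ᵇ⇒< _ _ holds , below , refl
      where
      I : Invariant i (built-V i)
      I = built-invariant i
      open IsFirstFrom (nextK-isFirst (built-L i) I)
      below : ∀ k → 2 ≤ k → k < built-K (suc i) → ℓform (a (suc i)) (built-V i) k ℤ.≤ + built-L i
      below k 2≤k k<K rewrite ℓform≡ℓ I k = +≤+ (≮⇒≥ λ L<ℓ → minimal k 2≤k k<K (<⇒<ᵇ L<ℓ))

  module Limit {V : ℕ → FinWord} {L K : ℕ → ℕ} (C : Construction a V L K) where

    2≤K : ∀ i → 2 ≤ K (suc i)
    2≤K i = proj₁ (proj₂ (proj₂ C) i)

    L-increasing : ∀ i → L i < L (suc i)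
    L-increasing i = proj₁ (proj₂ (proj₂ (proj₂ (proj₂ C) i)))

    V-step : ∀ i → V (suc i) ≡ step (V i) (K (suc i)) (L (suc i))
    V-step i = proj₂ (proj₂ (proj₂ (proj₂ (proj₂ (proj₂ C) i))))

    mutual
      invariant : ∀ i → Invariant i (V i)
      invariant zero    = subst (Invariant 0) (sym (proj₁ C)) V₀-invariant
      invariant (suc i) = subst (Invariant (suc i)) (sym (trans (V-step i) (cong (step (V i) (K (suc i))) (L≡ℓ i))))
        (invariant-step (invariant i) (2≤K i))

      L≡ℓ : ∀ i → L (suc i) ≡ ℓ i (V i) (K (suc i))
      L≡ℓ i = ℤP.+-injective (trans (proj₁ (proj₂ (proj₂ (proj₂ C) i))) (ℓform≡ℓ (invariant i) (K (suc i))))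

    i<|V| : ∀ i → i < length (V i)
    i<|V| i = ≤-trans (Invariant.many-ones (invariant i)) (ones≤length (V i))

    i≤L : ∀ i → i ≤ L i
    i≤L zero    = z≤n
    i≤L (suc i) = ≤-trans (s≤s (i≤L i)) (L-increasing i)

    V-≼ : ∀ {i j} → i ≤ j → V i ≼ V j
    V-≼ {i} {zero}  z≤n = ≼-refl
    V-≼ {i} {suc j} i≤ with m≤n⇒m<n∨m≡n i≤
    ... | inj₁ i<   = ≼-trans (V-≼ (s≤s⁻¹ i<)) (subst (V j ≼_) (sym (V-step j))
      (≼-step (Invariant.admissible (invariant j)) (≤-trans (s≤s z≤n) (2≤K j)) (L (suc j))))
    ... | inj₂ refl = ≼-refl

    v : InfWord
    v m = nth (V m) m

    v-agrees : ∀ m {y} → y < length (V m) → v y ≡ nth (V m) y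
    v-agrees m {y} y< with ≤-total y m
    ... | inj₁ y≤m = sym (nth-≼ (V-≼ y≤m) (i<|V| y))
    ... | inj₂ m≤y = nth-≼ (V-≼ m≤y) y<

    prefω-v : ∀ m {x} → x ≤ length (V m) → prefω v x ≡ take x (V m)
    prefω-v m x≤ = prefω-nth v (V m) (λ k k< → v-agrees m (<-≤-trans k< x≤)) x≤

    isLimit : IsLimit V v
    isLimit m = m , λ i m≤i → m<|V| i m≤i , sym (v-agrees i (m<|V| i m≤i))
      where
      m<|V| : ∀ i → m ≤ i → m < length (V i)
      m<|V| i m≤i = <-≤-trans (s≤s m≤i) (i<|V| i)

    prefixNormalω : PrefixNormalω v
    prefixNormalω i j = subst₂ _≤_ (cong ones (sym shifted)) (cong ones (sym (prefω-v m (≤-trans (m≤n+m i j) fits))))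
      (Admissible.prefixNormal (Invariant.admissible (invariant m)) i j fits)
      where
      m = j + i
      fits : j + i ≤ length (V m)
      fits = <⇒≤ (i<|V| m)
      i≤|drop| : i ≤ length (drop j (V m))
      i≤|drop| = ≤-trans (≤-reflexive (sym (m+n∸m≡n j i)))
        (≤-trans (∸-monoˡ-≤ j fits) (≤-reflexive (sym (length-drop j (V m)))))
      shifted : prefω (λ k → v (j + k)) i ≡ take i (drop j (V m))
      shifted = prefω-nth _ (drop j (V m))
        (λ k k<i → trans (v-agrees m (<-≤-trans (+-monoʳ-< j k<i) fits)) (sym (nth-drop (V m) j k))) i≤|drop|

    Dω≃ : ∀ i → toℚᵘ (Dω v i) ℚᵘ.≃ mkℚᵘ (+ ones (prefω v (suc i))) i
    Dω≃ i = ℚP.toℚᵘ-fromℚᵘ (mkℚᵘ (+ ones (prefω v (suc i))) i)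

    a≤Dω : ∀ i → a i ℚ.≤ Dω v i
    a≤Dω i = fraction-≤ (a≃ i) (Dω≃ i) (begin
      n i * suc i                       ≡⟨ *-comm (n i) (suc i) ⟩
      suc i * n i                       ≤⟨ Dense-weaken (Admissible.dense admissible) dense (suc i) (i<|V| i) ⟩
      P (V i) (suc i) * d i             ≡⟨ cong (λ w → ones w * d i) (prefω-v i (i<|V| i)) ⟨
      ones (prefω v (suc i)) * d i      ∎)
      where
      open ≤-Reasoning
      open Invariant (invariant i)
      instance
        |V|≢0 : ℕ.NonZero (length (V i))
        |V|≢0 = length-nonZero admissible

    inf-a≤inf-Dω : ∀ i ε → 0ℚ ℚ.< ε → ∃ λ m → a m ℚ.< Dω v i ℚ.+ ε
    inf-a≤inf-Dω i ε ε>0 = suc i , ℚP.<-≤-trans (a↓ i) (ℚP.≤-trans (a≤Dω i)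
      (ℚP.≤-trans (ℚP.≤-reflexive (sym (ℚP.+-identityʳ (Dω v i)))) (ℚP.+-monoʳ-≤ (Dω v i) (ℚP.<⇒≤ ε>0))))

    one-more-zero : ∀ j → ones (V (suc j)) * d (suc j) < n (suc j) * suc (length (V (suc j)))
    one-more-zero j = subst₂ (λ O′ N′ → O′ * d′ < n′ * suc N′) (sym ones-W) (sym length-W) (begin-strict
      k * O * d′                       ≡⟨ *-assoc k O d′ ⟩
      k * (O * d′)                     ≡⟨ cong (k *_) (m+[n∸m]≡n (<⇒≤ (denser-than-next I))) ⟨
      k * (n′ * N + Δ j (V j))         ≡⟨ *-distribˡ-+ k (n′ * N) (Δ j (V j)) ⟩
      k * (n′ * N) + k * Δ j (V j)     <⟨ +-monoʳ-< (k * (n′ * N)) kΔ< ⟩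
      k * (n′ * N) + suc ℓ′ * n′       ≡⟨ rearrange k n′ N ℓ′ ⟩
      n′ * suc (k * N + ℓ′)            ∎)
      where
      open ≤-Reasoning
      I : Invariant j (V j)
      I = invariant j
      k = K (suc j)
      ℓ′ = L (suc j)
      n′ = n (suc j)
      d′ = d (suc j)
      N = length (V j)
      O = ones (V j)
      1≤k : 1 ≤ k
      1≤k = ≤-trans (s≤s z≤n) (2≤K j)
      ones-W : ones (V (suc j)) ≡ k * O
      ones-W = trans (cong ones (V-step j)) (ones-step (Invariant.admissible I) 1≤k ℓ′)
      length-W : length (V (suc j)) ≡ k * N + ℓ′
      length-W = trans (cong length (V-step j)) (length-step (Invariant.admissible I) 1≤k ℓ′)
      kΔ< : k * Δ j (V j) < suc ℓ′ * n′
      kΔ< = subst (λ l → k * Δ j (V j) < suc l * n′) (sym (L≡ℓ j)) (proj₂ (div-bounds (k * Δ j (V j)) n′))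
      rearrange : ∀ k n N ℓ → k * (n * N) + suc ℓ * n ≡ n * suc (k * N + ℓ)
      rearrange = ℕ-solve-∀

    -- for j = m + (denominator of ε), the density at the end of v⁽ʲ⁺¹⁾ is below
    -- aⱼ₊₁ + 1/|v⁽ʲ⁺¹⁾| ≤ aₘ + ε
    inf-Dω≤inf-a : ∀ m ε → 0ℚ ℚ.< ε → ∃ λ i → Dω v i ℚ.< a m ℚ.+ ε
    inf-Dω≤inf-a m ε ε>0 = i , fraction-< (Dω≃ i) (fraction-+ (a≃ m) (ℚᵘP.≃-reflexive (toℚᵘ-positive ε>0)))
      (subst₂ (λ X Y → X * (d m * f) < (n m * f + e * d m) * Y) (sym X≡) (sym |W|≡) key)
      where
      open ≤-Reasoning
      e = num ε
      f = ↧ₙ ε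
      j = m + f
      W = V (suc j)
      instance
        e≢0 : ℕ.NonZero e
        e≢0 = num-nonZero ε>0
        |W|≢0 : ℕ.NonZero (length W)
        |W|≢0 = length-nonZero (Invariant.admissible (invariant (suc j)))
      i = ℕ.pred (length W)
      |W|≡ : suc i ≡ length W
      |W|≡ = suc-pred (length W)
      X≡ : ones (prefω v (suc i)) ≡ ones W
      X≡ = trans (cong ones (prefω-v (suc j) (≤-reflexive |W|≡)))
        (trans (cong (P W) |W|≡) (P-all W ≤-refl))
      below-a-m : ones W * d m < n m * suc (length W)
      below-a-m = cross-<-≤-trans {ones W} {suc (length W)} {n (suc j)} {d (suc j)} {n m} {d m}
        (one-more-zero j) (<⇒≤ (cross-antitone {m} {suc j} (s≤s (m≤m+n m f))))
      f≤|W| : f ≤ length W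
      f≤|W| = ≤-trans (m≤n+m f m) (≤-trans (n≤1+n j) (<⇒≤ (i<|V| (suc j))))
      nf≤edY : n m * f ≤ e * d m * length W
      nf≤edY = begin
        n m * f                    ≤⟨ *-mono-≤ (<⇒≤ (n<d m)) f≤|W| ⟩
        d m * length W             ≤⟨ m≤n*m (d m * length W) e ⟩
        e * (d m * length W)       ≡⟨ *-assoc e (d m) (length W) ⟨
        e * d m * length W         ∎
      expand : ∀ x Y f → x * suc Y * f ≡ x * f * Y + x * f
      expand = ℕ-solve-∀
      key : ones W * (d m * f) < (n m * f + e * d m) * length W
      key = begin-strict
        ones W * (d m * f)                        ≡⟨ *-assoc (ones W) (d m) f ⟨
        ones W * d m * f                          <⟨ *-monoˡ-< f below-a-m ⟩
        n m * suc (length W) * f                  ≡⟨ expand (n m) (length W) f ⟩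
        n m * f * length W + n m * f              ≤⟨ +-monoʳ-≤ (n m * f * length W) nf≤edY ⟩
        n m * f * length W + e * d m * length W   ≡⟨ *-distribʳ-+ (length W) (n m * f) (e * d m) ⟨
        (n m * f + e * d m) * length W            ∎

    zero-run : ∀ m → ∃ λ s → ∀ p → s ≤ p → p < s + L (suc m) → v p ≡ false
    zero-run m = length pre , zeros
      where
      pre = prefω (flipextω (V m)) (K (suc m) * length (V m))
      length-W : length (V (suc m)) ≡ length pre + L (suc m)
      length-W = trans (cong length (V-step m))
        (trans (length-++ pre) (cong (_+_ (length pre)) (length-replicate (L (suc m)))))
      zeros : ∀ p → length pre ≤ p → p < length pre + L (suc m) → v p ≡ false
      zeros p pre≤p p< = begin
        v p                                                  ≡⟨ v-agrees (suc m) (<-≤-trans p< (≤-reflexive (sym length-W))) ⟩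
        nth (V (suc m)) p                                    ≡⟨ cong (λ w → nth w p) (V-step m) ⟩
        nth (pre ++ replicate (L (suc m)) false) p           ≡⟨ nth-++-≥ pre _ pre≤p ⟩
        nth (replicate (L (suc m)) false) (p ∸ length pre)   ≡⟨ nth-zeros (L (suc m)) _ ⟩
        false                                                ∎
        where open ≡-Reasoning

    aperiodic : Aperiodic v
    aperiodic (x , b , us , periodic) with some-true-or-all-false (b ∷ us)
    ... | inj₂ all-false = <⇒≱ (Invariant.many-ones (invariant m)) (begin
      ones (V m)                          ≡⟨ cong ones (take-all _ (V m) ≤-refl) ⟨
      ones (take (length (V m)) (V m))    ≡⟨ cong ones (prefω-v m ≤-refl) ⟨
      ones (prefω v (length (V m)))       ≤⟨ ones-prefω-≤ v m tail-zero (length (V m)) ⟩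
      m                                   ∎)
      where
      open ≤-Reasoning
      m = length x
      tail-zero : ∀ p → m ≤ p → v p ≡ false
      tail-zero p m≤p =
        trans (periodic p) (trans (periodicWord-tail x b us m≤p) (all-false ((p ∸ m) % suc (length us))))
    ... | inj₁ (t , t<U , one) with zero-run (length x + 2 * suc (length us))
    ...   | s , zeros with periodic-one-in-window {v} {x} {b} {us} periodic t<U one s
    ...     | p , s≤p , p< , vp
      with trans (sym vp) (zeros p s≤p (<-≤-trans p< (+-monoʳ-≤ s (≤-trans (n≤1+n _) (i≤L _)))))
    ...       | ()

lemma3 : (a : ℕ → ℚ) →
    (∀ n → 0ℚ ℚ.< a n) → (∀ n → a n ℚ.< 1ℚ) → (∀ n → a (suc n) ℚ.< a n) →
    (Σ ℚ λ c → (0ℚ ℚ.< c) × (∀ n → c ℚ.≤ a n)) →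
    (∃ λ V → ∃ λ L → ∃ λ K → Construction a V L K) ×
    (∀ V L K → Construction a V L K →
      ∃ λ v → IsLimit V v × PrefixNormalω v × Aperiodic v × InfEq (Dω v) a)
lemma3 a a>0 a<1 a↓ _ = existence , λ V L K C → let open Limit {V} {L} {K} C in
  v , isLimit , prefixNormalω , aperiodic , inf-a≤inf-Dω , inf-Dω≤inf-a
  where open Build a a>0 a<1 a↓
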